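{- Let $n\geq 2$ be even, and let $\pi=\pi_1\cdots\pi_n\in S_n$ be a $2$-sorted permutation with exactly $\frac{n-2}{2}$ descents. Then the left-to-right maxima of $\pi$ are exactly $\pi_1,\pi_3,\pi_5,\ldots,\pi_{n-1},\pi_n$.
   Context: A permutation is a permutation of a finite set of positive integers written in one-line notation; $S_n$ is the set of permutations of $[n]=\{1,\dots,n\}$. West's stack-sorting map $s$ is defined as follows: given an input permutation $\pi=\pi_1\cdots\pi_n$, process it with an initially empty vertical stack; at each step, if the stack is empty or the next entry of the input is smaller than the entry at the top of the stack, push the next input entry onto the stack; otherwise pop the top entry of the stack and append it to the end of the output. When the output has length $n$, this output is $s(\pi)$. A permutation is $2$-sorted if it equals $s(s(\mu))$ for some permutation $\mu$. A descent of $\pi$ is an index $i\in[n-1]$ with $\pi_i>\pi_{i+1}$. A left-to-right maximum of $\pi$ is an entry $\pi_j$ that is larger than every entry $\pi_i$ with $i<j$. -}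

module Defs where

open import Data.Nat using (ℕ; zero; suc; _+_; _*_; _<_; _<?_)
open import Data.Bool using (if_then_else_)
open import Data.List using (List; []; _∷_; map; upTo; length; lookup)
open import Data.Fin using (Fin) renaming (_<_ to _<ᶠ_)
open import Data.Product using (Σ; _×_)
open import Relation.Nullary using (does)
open import Relation.Binary.PropositionalEquality using (_≡_)
open import Data.List.Relation.Binary.Permutation.Propositional using (_↭_)

IsPerm : ℕ → List ℕ → Set
IsPerm n π = π ↭ map suc (upTo n)

-- West's stack-sorting algorithm.
-- stackSort-go input stack : the stack is a list whose head is the top.
stackSort-go : List ℕ → List ℕ → List ℕ
stackSort-go []       stack       = stack
stackSort-go (x ∷ xs) []          = stackSort-go xs (x ∷ [])
stackSort-go (x ∷ xs) (t ∷ stack) =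
  if does (x <? t)
  then stackSort-go xs (x ∷ t ∷ stack)
  else t ∷ stackSort-go (x ∷ xs) stack

s : List ℕ → List ℕ
s π = stackSort-go π []

TwoSorted : ℕ → List ℕ → Set
TwoSorted n π = Σ (List ℕ) λ μ → IsPerm n μ × (s (s μ) ≡ π)

des : List ℕ → ℕ
des []           = 0
des (x ∷ [])     = 0
des (x ∷ y ∷ r)  = (if does (y <? x) then 1 else 0) + des (y ∷ r)

-- the entry at (0-based) position j is a left-to-right maximum
IsLRMax : (π : List ℕ) → Fin (length π) → Set
IsLRMax π j = ∀ (i : Fin (length π)) → i <ᶠ j → lookup π i < lookup π j

module Submission where

-- Everything rests on the recursion s(L M R) = s(L) s(R) M for the maximum M
-- of a list (s-decompose).  It gives, by induction on the length, that a
-- stack-sorted list of length m has at most (m - 1)/2 descents (few-s), and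
-- hence that s(s(μ)) = s(s(L) s(R)) M has at most (|μ| - 2)/2 descents
-- (two-sorted-bound).  In the extremal case this bound is attained by
-- s(s(L) s(R)), and the main lemma (zigzag-extremal) shows, by induction on k,
-- that equality forces the zigzag shape a₀ b₁ a₁ … bₖ aₖ: every way the
-- maximum entries could sit otherwise loses a descent.  The peaks aᵢ are
-- left-to-right maxima and the valleys bᵢ are not (zigzag-LR), which, with the
-- final maximum n, is exactly the statement (proposition1, at the end).

open import Defs
open import Data.Nat using (ℕ; zero; suc; _+_; _*_; _<_; _≤_; _<ᵇ_; z≤n; s≤s; pred)
open import Data.Nat.Properties
open import Data.Nat.Tactic.RingSolver using (solve-∀)
open import Data.Empty using (⊥; ⊥-elim)
open import Data.Bool using (true; false; if_then_else_; T)
open import Data.Unit using (tt)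
open import Data.Bool.Properties using (if-float; if-cong₂)
open import Data.List using (List; []; _∷_; _++_; length; lookup; upTo)
open import Data.Fin using (Fin; toℕ; fromℕ<)
open import Data.Fin.Properties using (toℕ-fromℕ<; toℕ<n)
open import Function.Bundles using (_⇔_; mk⇔; Equivalence)
open import Function.Construct.Composition using () renaming (equivalence to ⇔-trans)
open import Data.List.Properties using (++-assoc; length-++; ++-identityʳ; length-map; length-upTo)
open import Data.List.Relation.Unary.All as All using (All; []; _∷_)
open import Data.List.Relation.Unary.AllPairs using ([]; _∷_)
open import Data.List.Relation.Unary.Unique.Propositional using (Unique)
import Data.List.Relation.Unary.Unique.Propositional.Properties as Unique
import Data.List.Relation.Unary.All.Properties as All
open import Data.List.Relation.Binary.Permutation.Propositional using (_↭_; ↭⇒↭ₛ; ↭-refl; ↭-reflexive; ↭-sym; ↭-trans; prep)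
open import Data.List.Relation.Binary.Permutation.Propositional.Properties using (shift; All-resp-↭; ↭-length)
open import Data.Product using (Σ; Σ-syntax; _,_; proj₂)
open import Data.Sum using (_⊎_; inj₁; inj₂)
open import Relation.Nullary using (¬_; yes; no; does)
open import Relation.Nullary.Decidable using (dec-true; dec-false)
open import Relation.Binary.PropositionalEquality
open import Data.List.Relation.Binary.Permutation.Setoid.Properties (setoid ℕ) using (Unique-resp-↭)

if-elim : ∀ {A : Set} (P : A → Set) b {x y : A} → P x → P y → P (if b then x else y)
if-elim P true  px _  = px
if-elim P false _  py = py

go-↭ : ∀ xs st → stackSort-go xs st ↭ xs ++ st
go-↭ []       st       = ↭-refl
go-↭ (x ∷ xs) []       = ↭-trans (go-↭ xs (x ∷ [])) (shift x xs [])
go-↭ (x ∷ xs) (t ∷ st) = if-elim (_↭ x ∷ xs ++ t ∷ st) (x <ᵇ t)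
  (↭-trans (go-↭ xs (x ∷ t ∷ st)) (shift x xs (t ∷ st)))
  (↭-trans (prep t (go-↭ (x ∷ xs) st)) (↭-sym (shift t (x ∷ xs) st)))

s-↭ : ∀ Z → s Z ↭ Z
s-↭ Z = ↭-trans (go-↭ Z []) (↭-reflexive (++-identityʳ Z))

length-s : ∀ Z → length (s Z) ≡ length Z
length-s Z = ↭-length (s-↭ Z)

all-s : ∀ {P : ℕ → Set} {Z} → All P Z → All P (s Z)
all-s {Z = Z} = All-resp-↭ (↭-sym (s-↭ Z))

go-buried : ∀ {M} R S S₂ → All (_< M) R → All (_< M) S →
            stackSort-go R (S ++ M ∷ S₂) ≡ stackSort-go R S ++ M ∷ S₂
go-buried [] S S₂ _ _ = refl
go-buried {M} (x ∷ xs) [] S₂ (x<M ∷ R<M) _ rewrite dec-true (x <? M) x<M =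
  go-buried xs (x ∷ []) S₂ R<M (x<M ∷ [])
go-buried {M} (x ∷ xs) (t ∷ S) S₂ (x<M ∷ R<M) (t<M ∷ S<M) =
  trans (if-cong₂ (x <ᵇ t) (go-buried xs (x ∷ t ∷ S) S₂ R<M (x<M ∷ t<M ∷ S<M))
                           (cong (t ∷_) (go-buried (x ∷ xs) S S₂ (x<M ∷ R<M) S<M)))
        (sym (if-float (_++ M ∷ S₂) (x <ᵇ t)))

-- When an input entry M is at least every entry before it and on the stack,
-- it empties the stack on arrival and then sits at the bottom.
go-max-input : ∀ {M} L S R → All (_≤ M) L → All (_≤ M) S →
               stackSort-go (L ++ M ∷ R) S ≡ stackSort-go L S ++ stackSort-go R (M ∷ [])
go-max-input [] [] R _ _ = refl
go-max-input {M} [] (t ∷ S) R _ (t≤M ∷ S≤M) rewrite dec-false (M <? t) (≤⇒≯ t≤M) =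
  cong (t ∷_) (go-max-input [] S R [] S≤M)
go-max-input (x ∷ xs) [] R (x≤M ∷ L≤M) _ = go-max-input xs (x ∷ []) R L≤M (x≤M ∷ [])
go-max-input {M} (x ∷ xs) (t ∷ S) R (x≤M ∷ L≤M) (t≤M ∷ S≤M) =
  trans (if-cong₂ (x <ᵇ t) (go-max-input xs (x ∷ t ∷ S) R L≤M (x≤M ∷ t≤M ∷ S≤M))
                           (cong (t ∷_) (go-max-input (x ∷ xs) S R (x≤M ∷ L≤M) S≤M)))
        (sym (if-float (_++ stackSort-go R (M ∷ [])) (x <ᵇ t)))

s-decompose : ∀ {M} L R → All (_≤ M) L → All (_< M) R → s (L ++ M ∷ R) ≡ s L ++ s R ++ M ∷ []
s-decompose L R L≤M R<M =
  trans (go-max-input L [] R L≤M []) (cong (s L ++_) (go-buried R [] [] R<M []))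

record MaxSplit (Z : List ℕ) : Set where
  constructor maxSplit
  field
    left    : List ℕ
    max     : ℕ
    right   : List ℕ
    split   : Z ≡ left ++ max ∷ right
    left≤   : All (_≤ max) left
    right<  : All (_< max) right

splitMax : ∀ z Z → MaxSplit (z ∷ Z)
splitMax z [] = maxSplit [] z [] refl [] []
splitMax z (y ∷ Z) with splitMax y Z
... | maxSplit L M R eq L≤M R<M with z ≤? M
...   | yes z≤M = maxSplit (z ∷ L) M R (cong (z ∷_) eq) (z≤M ∷ L≤M) R<M
...   | no z≰M  = maxSplit [] z (y ∷ Z) refl [] (subst (All (_< z)) (sym eq)
                    (All.++⁺ (All.map (λ p → ≤-<-trans p M<z) L≤M) (M<z ∷ All.map (λ p → <-trans p M<z) R<M)))
  where M<z = ≰⇒> z≰M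

split-bounded : ∀ {Z} (sp : MaxSplit Z) → All (_≤ MaxSplit.max sp) Z
split-bounded (maxSplit L M R refl L≤M R<M) = All.++⁺ L≤M (≤-refl ∷ All.map <⇒≤ R<M)

s-split : ∀ {Z} (sp : MaxSplit Z) → let open MaxSplit sp in
          s Z ≡ (s left ++ s right) ++ max ∷ []
s-split (maxSplit L M R refl L≤M R<M) =
  trans (s-decompose L R L≤M R<M) (sym (++-assoc (s L) (s R) (M ∷ [])))

length-split : ∀ {Z} L (M : ℕ) R → Z ≡ L ++ M ∷ R → length Z ≡ suc (length L + length R)
length-split L M R refl = trans (length-++ L) (+-suc (length L) (length R))

length-s++s : ∀ L R → length (s L ++ s R) ≡ length L + length R
length-s++s L R = trans (length-++ (s L)) (cong₂ _+_ (length-s L) (length-s R))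

isDescent : ℕ → ℕ → ℕ
isDescent x y = if does (y <? x) then 1 else 0

isDescent≤1 : ∀ x y → isDescent x y ≤ 1
isDescent≤1 x y with does (y <? x)
... | true  = ≤-refl
... | false = z≤n

isDescent-pos : ∀ x y → 1 ≤ isDescent x y → y < x
isDescent-pos x y h = <ᵇ⇒< y x (counted (y <ᵇ x) h)
  where
  counted : ∀ b → 1 ≤ (if b then 1 else 0) → T b
  counted true  _ = tt

des-++-max : ∀ {M} Z → All (_≤ M) Z → des (Z ++ M ∷ []) ≡ des Z
des-++-max []          _           = refl
des-++-max {M} (z ∷ []) (z≤M ∷ _) rewrite dec-false (M <? z) (≤⇒≯ z≤M) = refl
des-++-max (z ∷ y ∷ Z) (_ ∷ Z≤M)   = cong (isDescent z y +_) (des-++-max (y ∷ Z) Z≤M)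

des-++ : ∀ A B → des (A ++ B) ≤ suc (des A + des B)
des-++ []          B       = n≤1+n (des B)
des-++ (x ∷ [])    []      = z≤n
des-++ (x ∷ [])    (y ∷ B) = +-monoˡ-≤ (des (y ∷ B)) (isDescent≤1 x y)
des-++ (x ∷ y ∷ A) B       = begin
  isDescent x y + des (y ∷ A ++ B)               ≤⟨ +-monoʳ-≤ (isDescent x y) (des-++ (y ∷ A) B) ⟩
  isDescent x y + suc (des (y ∷ A) + des B)      ≡⟨ +-suc (isDescent x y) _ ⟩
  suc (isDescent x y + (des (y ∷ A) + des B))    ≡⟨ cong suc (sym (+-assoc (isDescent x y) _ _)) ⟩
  suc (isDescent x y + des (y ∷ A) + des B)      ∎
  where open ≤-Reasoning

snoc-descent : ∀ A x y → suc (des (A ++ x ∷ [])) ≤ des (A ++ x ∷ y ∷ []) → y < x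
snoc-descent []          x y h = isDescent-pos x y (subst (1 ≤_) (+-identityʳ _) h)
snoc-descent (a ∷ [])    x y h = snoc-descent [] x y (+-cancelˡ-≤ (isDescent a x) _ _
                                   (subst (_≤ isDescent a x + des (x ∷ y ∷ [])) (sym (+-suc (isDescent a x) _)) h))
snoc-descent (a ∷ b ∷ A) x y h = snoc-descent (b ∷ A) x y (+-cancelˡ-≤ (isDescent a b) _ _
                                   (subst (_≤ isDescent a b + des (b ∷ A ++ x ∷ y ∷ [])) (sym (+-suc (isDescent a b) _)) h))

double-≤ : ∀ d a b m n → d ≤ suc (a + b) → a + a ≤ m → b + b ≤ n → d + d ≤ suc m + suc n
double-≤ d a b m n d≤ a≤ b≤ = begin
  d + d                          ≤⟨ +-mono-≤ d≤ d≤ ⟩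
  suc (a + b) + suc (a + b)      ≡⟨ regroup a b ⟩
  suc (a + a) + suc (b + b)      ≤⟨ +-mono-≤ (s≤s a≤) (s≤s b≤) ⟩
  suc m + suc n                  ∎
  where
  open ≤-Reasoning
  regroup : ∀ a b → suc (a + b) + suc (a + b) ≡ suc (a + a) + suc (b + b)
  regroup = solve-∀

halve : ∀ d j → d + d ≤ suc (j + j) → d ≤ j
halve d j h with d ≤? j
... | yes d≤j = d≤j
... | no  d≰j = ⊥-elim (<⇒≱ (subst (_≤ d + d) (cong suc (+-suc j j)) (+-mono-≤ j<d j<d)) h)
  where j<d = ≰⇒> d≰j

too-many : ∀ {j d m} → m ≡ suc (suc (j + j)) → d + d ≤ pred m → suc j ≤ d → ⊥
too-many refl bound h = <⇒≱ h (halve _ _ bound)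

twice-suc : ∀ j → suc j + suc j ≡ suc (suc (j + j))
twice-suc j = cong suc (+-suc j j)

Even : ℕ → Set
Even q = Σ[ m ∈ ℕ ] q ≡ 2 * m

double : ∀ m → 2 * m ≡ m + m
double m = cong (m +_) (+-identityʳ m)

double-suc : ∀ k → 2 * suc k ≡ suc (suc (k + k))
double-suc k = trans (double (suc k)) (twice-suc k)

odd≢double : ∀ j m → suc (j + j) ≢ m + m
odd≢double j       zero    ()
odd≢double zero    (suc m) eq = 0≢1+n (trans (suc-injective eq) (+-suc m m))
odd≢double (suc j) (suc m) eq = odd≢double j m (suc-injective (begin
  suc (suc (j + j))   ≡⟨ cong suc (sym (+-suc j j)) ⟩
  suc (j + suc j)     ≡⟨ suc-injective eq ⟩
  m + suc m           ≡⟨ +-suc m m ⟩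
  suc (m + m)         ∎))
  where open ≡-Reasoning

odd-not-even : ∀ j → ¬ Even (suc (j + j))
odd-not-even j (m , eq) = odd≢double j m (trans eq (double m))

FewDescents : List ℕ → Set
FewDescents X = des X + des X ≤ pred (length X)

few-++ : ∀ A Q → FewDescents A → FewDescents Q →
         des (A ++ Q) + des (A ++ Q) ≤ length A + length Q
few-++ []      Q       _  fQ = ≤-trans fQ pred[n]≤n
few-++ (x ∷ A) []      fA _  rewrite ++-identityʳ A = ≤-trans fA (≤-trans (n≤1+n _) (m≤m+n _ 0))
few-++ (x ∷ A) (y ∷ Q) fA fQ = double-≤ _ (des (x ∷ A)) (des (y ∷ Q)) _ _ (des-++ (x ∷ A) (y ∷ Q)) fA fQ

few-++-strict : ∀ A Q → FewDescents A → des Q + des Q ≤ pred (pred (length Q)) → 2 ≤ length Q →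
                des (A ++ Q) + des (A ++ Q) ≤ pred (length A + length Q)
few-++-strict []      Q           _  fQ _ = ≤-trans fQ pred[n]≤n
few-++-strict (x ∷ A) (y ∷ z ∷ Q) fA fQ _ =
  ≤-trans (double-≤ _ (des (x ∷ A)) (des (y ∷ z ∷ Q)) _ _ (des-++ (x ∷ A) (y ∷ z ∷ Q)) fA fQ)
          (≤-reflexive (sym (+-suc (length A) (suc (length Q)))))
few-++-strict (x ∷ A) (y ∷ [])    _  _  (s≤s ())

few-snoc-max : ∀ {M} Y → All (_≤ M) Y → des Y + des Y ≤ length Y → FewDescents (Y ++ M ∷ [])
few-snoc-max {M} Y Y≤M h rewrite des-++-max Y Y≤M | length-++ Y {M ∷ []} | +-comm (length Y) 1 = h

few-s : ∀ Z → FewDescents (s Z)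
few-s Z = bounded (length Z) Z ≤-refl
  where
  -- strong induction on the length, via a bound n
  bounded : ∀ n Z → length Z ≤ n → FewDescents (s Z)
  bounded _       []      _       = z≤n
  bounded (suc n) (z ∷ Z) (s≤s h) with splitMax z Z
  ... | sp@(maxSplit L M R eq L≤M R<M) = subst FewDescents (sym (s-split sp))
    (few-snoc-max (s L ++ s R) (All.++⁺ (all-s L≤M) (all-s (All.map <⇒≤ R<M)))
      (subst (des (s L ++ s R) + des (s L ++ s R) ≤_) (sym (length-++ (s L)))
        (few-++ (s L) (s R) (bounded n L (≤-trans (m≤m+n _ _) |LR|≤n))
                            (bounded n R (≤-trans (m≤n+m _ _) |LR|≤n)))))
    where
    |LR|≤n : length L + length R ≤ n
    |LR|≤n = subst (_≤ n) (suc-injective (length-split L M R eq)) h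

ends-with-max-bound : ∀ {M} Y → All (_≤ M) Y → des (s (Y ++ M ∷ [])) + des (s (Y ++ M ∷ [])) ≤ pred (length Y)
ends-with-max-bound Y Y≤M
  rewrite s-decompose Y [] Y≤M [] | des-++-max (s Y) (all-s Y≤M) | sym (length-s Y) = few-s Y

two-sorted-bound : ∀ W → des (s (s W)) + des (s (s W)) ≤ pred (pred (length W))
two-sorted-bound []      = z≤n
two-sorted-bound (z ∷ Z) with splitMax z Z
... | sp@(maxSplit L M R eq L≤M R<M) rewrite s-split sp =
  subst (λ n → des (s ((s L ++ s R) ++ M ∷ [])) + des (s ((s L ++ s R) ++ M ∷ [])) ≤ pred n)
        (trans (length-s++s L R) (suc-injective (sym (length-split L M R eq))))
        (ends-with-max-bound (s L ++ s R) (All.++⁺ (all-s L≤M) (all-s (All.map <⇒≤ R<M))))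

unique-++ˡ : ∀ xs {ys : List ℕ} → Unique (xs ++ ys) → Unique xs
unique-++ˡ []       _       = []
unique-++ˡ (x ∷ xs) (p ∷ u) = All.++⁻ˡ xs p ∷ unique-++ˡ xs u

unique-remove : ∀ xs {y : ℕ} {ys} → Unique (xs ++ y ∷ ys) → Unique (xs ++ ys)
unique-remove []       (_ ∷ u) = u
unique-remove (x ∷ xs) (p ∷ u) = All.++⁺ (All.++⁻ˡ xs p) (All.tail (All.++⁻ʳ xs p)) ∷ unique-remove xs u

unique-before : ∀ xs {y : ℕ} {ys} → Unique (xs ++ y ∷ ys) → All (_≢ y) xs
unique-before []       _       = []
unique-before (x ∷ xs) (p ∷ u) = All.head (All.++⁻ʳ xs p) ∷ unique-before xs u

strict-left : ∀ L {M : ℕ} {R} → Unique (L ++ M ∷ R) → All (_≤ M) L → All (_< M) L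
strict-left L u L≤M = All.zipWith (λ (x≤M , x≢M) → ≤∧≢⇒< x≤M x≢M) (L≤M , unique-before L u)

perm-unique : ∀ {n μ} → IsPerm n μ → Unique μ
perm-unique {n} μ↭ = Unique-resp-↭ (↭⇒↭ₛ (↭-sym μ↭)) (Unique.map⁺ suc-injective (Unique.upTo⁺ n))

perm-length : ∀ {n μ} → IsPerm n μ → length μ ≡ n
perm-length {n} μ↭ = trans (↭-length μ↭) (trans (length-map suc (upTo n)) (length-upTo n))

-- Zigzag j P x : P = a₀ b₁ a₁ … bⱼ aⱼ with x = aⱼ, where every peak aᵢ
-- exceeds all entries before it and every valley bᵢ lies below both of its
-- neighbours.  This is the shape of an extremal 2-sorted permutation minus
-- its final entry n.
data Zigzag : ℕ → List ℕ → ℕ → Set where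
  single : ∀ a → Zigzag 0 (a ∷ []) a
  extend : ∀ {j P x b a} → Zigzag j P x → All (_< a) P → b < a → b < x →
           Zigzag (suc j) (P ++ b ∷ a ∷ []) a

zigzag-last : ∀ {j P x} → Zigzag j P x → Σ[ P′ ∈ List ℕ ] P ≡ P′ ++ x ∷ []
zigzag-last (single a)                       = [] , refl
zigzag-last (extend {P = P} {b = b} {a} _ _ _ _) = P ++ b ∷ [] , sym (++-assoc P (b ∷ []) (a ∷ []))

zigzag-length : ∀ {j P x} → Zigzag j P x → length P ≡ suc (j + j)
zigzag-length (single a) = refl
zigzag-length (extend {j} {P} {b = b} {a} zP _ _ _) =
  trans (length-++ P) (trans (cong (_+ 2) (zigzag-length zP)) (two-more j))
  where
  two-more : ∀ j → suc (j + j) + 2 ≡ suc (suc j + suc j)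
  two-more = solve-∀

zigzag-extend : ∀ {j A x} b a → Zigzag j A x → des A ≤ j → All (_< a) A → b < a →
                suc j ≤ des (A ++ b ∷ []) → Zigzag (suc j) (A ++ b ∷ a ∷ []) a
zigzag-extend {j} {A} {x} b a zA desA≤j A<a b<a h with zigzag-last zA
... | A′ , refl = extend zA A<a b<a (snoc-descent A′ x b (≤-trans (s≤s desA≤j)
                    (subst (suc j ≤_) (cong des (++-assoc A′ (x ∷ []) (b ∷ []))) h)))

singleton-zigzag : ∀ Y → length Y ≡ 1 → Σ ℕ (Zigzag 0 (s Y))
singleton-zigzag (y ∷ []) _ = y , single y

++-reassoc : ∀ (a b c : List ℕ) (M : ℕ) → (a ++ b ++ M ∷ []) ++ c ≡ (a ++ b) ++ M ∷ c
++-reassoc a b c M = begin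
  (a ++ b ++ M ∷ []) ++ c    ≡⟨ ++-assoc a (b ++ M ∷ []) c ⟩
  a ++ (b ++ M ∷ []) ++ c    ≡⟨ cong (a ++_) (++-assoc b (M ∷ []) c) ⟩
  a ++ b ++ M ∷ c            ≡⟨ sym (++-assoc a b (M ∷ c)) ⟩
  (a ++ b) ++ M ∷ c          ∎
  where open ≡-Reasoning

second-pass : ∀ L₁ M L₂ R → All (_< M) L₁ → All (_< M) L₂ → All (_< M) R →
              s (s (L₁ ++ M ∷ L₂) ++ s R) ≡ s (s L₁ ++ s L₂) ++ s (s R) ++ M ∷ []
second-pass L₁ M L₂ R L₁<M L₂<M R<M = begin
  s (s (L₁ ++ M ∷ L₂) ++ s R)           ≡⟨ cong (λ X → s (X ++ s R)) (s-decompose L₁ L₂ (All.map <⇒≤ L₁<M) L₂<M) ⟩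
  s ((s L₁ ++ s L₂ ++ M ∷ []) ++ s R)   ≡⟨ cong s (++-reassoc (s L₁) (s L₂) (s R) M) ⟩
  s ((s L₁ ++ s L₂) ++ M ∷ s R)         ≡⟨ s-decompose (s L₁ ++ s L₂) (s R) Y≤M (all-s R<M) ⟩
  s (s L₁ ++ s L₂) ++ s (s R) ++ M ∷ [] ∎
  where
  open ≡-Reasoning
  Y≤M = All.map <⇒≤ (All.++⁺ (all-s L₁<M) (all-s L₂<M))

second-pass-des : ∀ L₁ M L₂ R → All (_< M) L₁ → All (_< M) L₂ → All (_< M) R →
                  des (s (s (L₁ ++ M ∷ L₂) ++ s R)) ≡ des (s (s L₁ ++ s L₂) ++ s (s R))
second-pass-des L₁ M L₂ R L₁<M L₂<M R<M = begin
  des (s (s (L₁ ++ M ∷ L₂) ++ s R))            ≡⟨ cong des (second-pass L₁ M L₂ R L₁<M L₂<M R<M) ⟩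
  des (A ++ s (s R) ++ M ∷ [])                  ≡⟨ cong des (sym (++-assoc A (s (s R)) (M ∷ []))) ⟩
  des ((A ++ s (s R)) ++ M ∷ [])                ≡⟨ des-++-max (A ++ s (s R)) (All.map <⇒≤ (All.++⁺ A<M (all-s (all-s R<M)))) ⟩
  des (A ++ s (s R))                            ∎
  where
  open ≡-Reasoning
  A = s (s L₁ ++ s L₂)
  A<M : All (_< M) A
  A<M = all-s (All.++⁺ (all-s L₁<M) (all-s L₂<M))

-- If the maximum of L ++ Z lies in Z, then s(L) s(Z) ends with that maximum,
-- so s(s(L) s(Z)) has too few descents to be extremal.
max-on-right-refuted : ∀ j L {Z} (sp : MaxSplit Z) → All (_≤ MaxSplit.max sp) L →
  length L + length Z ≡ suc (suc j + suc j) → suc j ≤ des (s (s L ++ s Z)) → ⊥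
max-on-right-refuted j L (maxSplit R₁ M R₂ refl R₁≤M R₂<M) L≤M len h =
  too-many |Y₀| (ends-with-max-bound Y₀ Y₀≤M) (subst (λ Y → suc j ≤ des (s Y)) Y≡Y₀M h)
  where
  Y₀ = s L ++ s R₁ ++ s R₂
  Y₀≤M : All (_≤ M) Y₀
  Y₀≤M = All.++⁺ (all-s L≤M) (All.++⁺ (all-s R₁≤M) (all-s (All.map <⇒≤ R₂<M)))
  Y≡Y₀M : s L ++ s (R₁ ++ M ∷ R₂) ≡ Y₀ ++ M ∷ []
  Y≡Y₀M = begin
    s L ++ s (R₁ ++ M ∷ R₂)          ≡⟨ cong (s L ++_) (s-decompose R₁ R₂ R₁≤M R₂<M) ⟩
    s L ++ s R₁ ++ s R₂ ++ M ∷ []    ≡⟨ cong (s L ++_) (sym (++-assoc (s R₁) (s R₂) (M ∷ []))) ⟩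
    s L ++ (s R₁ ++ s R₂) ++ M ∷ []  ≡⟨ sym (++-assoc (s L) (s R₁ ++ s R₂) (M ∷ [])) ⟩
    Y₀ ++ M ∷ []                     ∎
    where open ≡-Reasoning
  |Y₀| : length Y₀ ≡ suc (suc (j + j))
  |Y₀| = suc-injective (begin
    suc (length Y₀)                                 ≡⟨ cong suc (trans (length-++ (s L)) (cong₂ _+_ (length-s L) (length-s++s R₁ R₂))) ⟩
    suc (length L + (length R₁ + length R₂))       ≡⟨ sym (+-suc (length L) _) ⟩
    length L + suc (length R₁ + length R₂)         ≡⟨ cong (length L +_) (sym (length-split R₁ M R₂ refl)) ⟩
    length L + length (R₁ ++ M ∷ R₂)               ≡⟨ len ⟩
    suc (suc j + suc j)                             ≡⟨ cong suc (twice-suc j) ⟩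
    suc (suc (suc (j + j)))                         ∎)
    where open ≡-Reasoning

long-right-refuted : ∀ j L₁ M L₂ R → All (_< M) L₁ → All (_< M) L₂ → All (_< M) R → 2 ≤ length R →
  length (L₁ ++ M ∷ L₂) + length R ≡ suc (suc j + suc j) → suc j ≤ des (s (s (L₁ ++ M ∷ L₂) ++ s R)) → ⊥
long-right-refuted j L₁ M L₂ R L₁<M L₂<M R<M 2≤|R| len h =
  too-many |A|+|Q| (few-++-strict A Q (few-s (s L₁ ++ s L₂)) Q-bound (subst (2 ≤_) (sym |Q|) 2≤|R|))
           (subst (suc j ≤_) (second-pass-des L₁ M L₂ R L₁<M L₂<M R<M) h)
  where
  A = s (s L₁ ++ s L₂)
  Q = s (s R)
  |Q| : length Q ≡ length R
  |Q| = trans (length-s (s R)) (length-s R)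
  Q-bound : des Q + des Q ≤ pred (pred (length Q))
  Q-bound = subst (λ n → des Q + des Q ≤ pred (pred n)) (sym |Q|) (two-sorted-bound R)
  |A|+|Q| : length A + length Q ≡ suc (suc (j + j))
  |A|+|Q| = suc-injective (begin
    suc (length A + length Q)               ≡⟨ cong₂ (λ a q → suc (a + q)) (trans (length-s (s L₁ ++ s L₂)) (length-s++s L₁ L₂)) |Q| ⟩
    suc (length L₁ + length L₂) + length R  ≡⟨ cong (_+ length R) (sym (length-split L₁ M L₂ refl)) ⟩
    length (L₁ ++ M ∷ L₂) + length R        ≡⟨ len ⟩
    suc (suc j + suc j)                     ≡⟨ cong suc (twice-suc j) ⟩
    suc (suc (suc (j + j)))                 ∎)
    where open ≡-Reasoning

-- Let L ++ R have no repetitions and length 2j + 1, so that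
-- s(L) s(R) is s(L M R) without its final maximum M.
-- By induction on j: the maximum M₁ of L must beat the maximum of R, R must be
-- a single entry b, and then s(s(L) s(R)) = s(s(L₁) s(L₂)) b M₁ extends the
-- zigzag obtained for L = L₁ M₁ L₂.
mutual
  zigzag-extremal : ∀ j L R → Unique (L ++ R) → length L + length R ≡ suc (j + j) →
                    j ≤ des (s (s L ++ s R)) → Σ ℕ (Zigzag j (s (s L ++ s R)))
  zigzag-extremal zero    L       R       _ len _ = singleton-zigzag (s L ++ s R) (trans (length-s++s L R) len)
  -- if L or R is empty, s(s(L) s(R)) is 2-sorted and too short to have j + 1 descents
  zigzag-extremal (suc j) []      R       _ len h =
    ⊥-elim (too-many (trans (cong pred len) (twice-suc j)) (two-sorted-bound R) h)
  zigzag-extremal (suc j) (l ∷ L) []      _ len h rewrite ++-identityʳ (s (l ∷ L)) | +-identityʳ (length L) =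
    ⊥-elim (too-many (trans (cong pred len) (twice-suc j)) (two-sorted-bound (l ∷ L)) h)
  zigzag-extremal (suc j) (l ∷ L) (r ∷ R) u len h = zigzag-split j (splitMax l L) r R u len h

  zigzag-split : ∀ j {L} → MaxSplit L → ∀ r R → Unique (L ++ r ∷ R) →
                 length L + length (r ∷ R) ≡ suc (suc j + suc j) → suc j ≤ des (s (s L ++ s (r ∷ R))) →
                 Σ ℕ (Zigzag (suc j) (s (s L ++ s (r ∷ R))))
  zigzag-split j spL@(maxSplit L₁ M₁ L₂ refl L₁≤M₁ L₂<M₁) r R u len h with splitMax r R
  ... | spR@(maxSplit _ M₂ _ _ _ _) with M₂ <? M₁
  ...   | no M₂≮M₁ = ⊥-elim (max-on-right-refuted j (L₁ ++ M₁ ∷ L₂) spR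
                       (All.map (λ x≤M₁ → ≤-trans x≤M₁ (≮⇒≥ M₂≮M₁)) (split-bounded spL))
                       len h)
  ...   | yes M₂<M₁ = zigzag-descending j L₁ M₁ L₂ r R L₁<M₁ L₂<M₁ R<M₁ (unique-remove L₁ uL) len h
    where
    uL = unique-++ˡ (L₁ ++ M₁ ∷ L₂) u
    L₁<M₁ = strict-left L₁ uL L₁≤M₁
    R<M₁ = All.map (λ x≤M₂ → ≤-<-trans x≤M₂ M₂<M₁) (split-bounded spR)

  -- M₁ > M₂: R must be a single valley b, below the last peak of the zigzag for L₁, L₂
  zigzag-descending : ∀ j L₁ M L₂ b R → All (_< M) L₁ → All (_< M) L₂ → All (_< M) (b ∷ R) →
    Unique (L₁ ++ L₂) → length (L₁ ++ M ∷ L₂) + length (b ∷ R) ≡ suc (suc j + suc j) →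
    suc j ≤ des (s (s (L₁ ++ M ∷ L₂) ++ s (b ∷ R))) → Σ ℕ (Zigzag (suc j) (s (s (L₁ ++ M ∷ L₂) ++ s (b ∷ R))))
  zigzag-descending j L₁ M L₂ r (r′ ∷ R) L₁<M L₂<M R<M _ len h =
    ⊥-elim (long-right-refuted j L₁ M L₂ (r ∷ r′ ∷ R) L₁<M L₂<M R<M (s≤s (s≤s z≤n)) len h)
  zigzag-descending j L₁ M L₂ b [] L₁<M L₂<M (b<M ∷ []) u len h =
    M , subst (λ P → Zigzag (suc j) P M) (sym (second-pass L₁ M L₂ (b ∷ []) L₁<M L₂<M (b<M ∷ [])))
              (zigzag-extend b M (proj₂ zigzag-A) desA≤j A<M b<M h′)
    where
    A = s (s L₁ ++ s L₂)
    A<M = all-s (All.++⁺ (all-s L₁<M) (all-s L₂<M))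
    h′ : suc j ≤ des (A ++ b ∷ [])
    h′ = subst (suc j ≤_) (second-pass-des L₁ M L₂ (b ∷ []) L₁<M L₂<M (b<M ∷ [])) h
    |L₁|+|L₂| : length L₁ + length L₂ ≡ suc (j + j)
    |L₁|+|L₂| = suc-injective (suc-injective (begin
      suc (suc (length L₁ + length L₂))   ≡⟨ +-comm 1 (suc (length L₁ + length L₂)) ⟩
      suc (length L₁ + length L₂) + 1     ≡⟨ cong (_+ 1) (sym (length-split L₁ M L₂ refl)) ⟩
      length (L₁ ++ M ∷ L₂) + 1           ≡⟨ len ⟩
      suc (suc j + suc j)                 ≡⟨ cong suc (twice-suc j) ⟩
      suc (suc (suc (j + j)))             ∎))
      where open ≡-Reasoning
    -- A has at most j descents, and at least j since appending b adds at most one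
    desA≤j : des A ≤ j
    desA≤j = halve (des A) j (≤-trans (subst (λ n → des A + des A ≤ pred n)
               (trans (length-s (s L₁ ++ s L₂)) (trans (length-s++s L₁ L₂) |L₁|+|L₂|)) (few-s (s L₁ ++ s L₂)))
               (n≤1+n _))
    j≤desA : j ≤ des A
    j≤desA = ≤-pred (≤-trans h′ (≤-trans (des-++ A (b ∷ [])) (≤-reflexive (cong suc (+-identityʳ (des A))))))
    zigzag-A : Σ ℕ (Zigzag j A)
    zigzag-A = zigzag-extremal j L₁ L₂ u |L₁|+|L₂| j≤desA

data ExtremalShape (k : ℕ) : List ℕ → Set where
  zigzag-then-max : ∀ {P x M} → Zigzag k P x → All (_< M) P → ExtremalShape k (P ++ M ∷ [])

-- Extremal 2-sorted lists have this shape: writing μ = L M R with M maximal,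
-- s(s(μ)) = s(s(L) s(R)) M and the main lemma applies to s(s(L) s(R)).
two-sorted-extremal : ∀ k μ → Unique μ → length μ ≡ suc (suc (k + k)) → k ≤ des (s (s μ)) →
                      ExtremalShape k (s (s μ))
two-sorted-extremal k (z ∷ Z) u len h with splitMax z Z
... | sp@(maxSplit L M R eq L≤M R<M) =
  subst (ExtremalShape k) (sym ss-split)
    (zigzag-then-max (proj₂ (zigzag-extremal k L R (unique-remove L u′) |L|+|R| h′))
                     (all-s (All.++⁺ (all-s (strict-left L u′ L≤M)) (all-s R<M))))
  where
  u′ = subst Unique eq u
  Y≤M = All.++⁺ (all-s L≤M) (all-s (All.map <⇒≤ R<M))
  ss-split : s (s (z ∷ Z)) ≡ s (s L ++ s R) ++ M ∷ []
  ss-split = trans (cong s (s-split sp)) (s-decompose (s L ++ s R) [] Y≤M [])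
  h′ : k ≤ des (s (s L ++ s R))
  h′ = subst (k ≤_) (trans (cong des ss-split) (des-++-max (s (s L ++ s R)) (all-s Y≤M))) h
  |L|+|R| : length L + length R ≡ suc (k + k)
  |L|+|R| = suc-injective (trans (sym (length-split L M R eq)) len)

-- Entries by natural-number position (0 outside the list).
nth : List ℕ → ℕ → ℕ
nth []       _       = 0
nth (x ∷ xs) zero    = x
nth (x ∷ xs) (suc i) = nth xs i

LRMaxAt : List ℕ → ℕ → Set
LRMaxAt P q = ∀ i → i < q → nth P i < nth P q

lookup-nth : ∀ xs (i : Fin (length xs)) → lookup xs i ≡ nth xs (toℕ i)
lookup-nth (x ∷ xs) Fin.zero    = refl
lookup-nth (x ∷ xs) (Fin.suc i) = lookup-nth xs i

isLRMax⇔LRMaxAt : ∀ xs (j : Fin (length xs)) → IsLRMax xs j ⇔ LRMaxAt xs (toℕ j)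
isLRMax⇔LRMaxAt xs j = mk⇔
  (λ lr i i<j → let i<n = <-trans i<j (toℕ<n j) in
     subst₂ _<_ (trans (lookup-nth xs (fromℕ< i<n)) (cong (nth xs) (toℕ-fromℕ< i<n))) (lookup-nth xs j)
            (lr (fromℕ< i<n) (subst (_< toℕ j) (sym (toℕ-fromℕ< i<n)) i<j)))
  (λ lr i i<j → subst₂ _<_ (sym (lookup-nth xs i)) (sym (lookup-nth xs j)) (lr (toℕ i) i<j))

nth-++ˡ : ∀ xs ys i → i < length xs → nth (xs ++ ys) i ≡ nth xs i
nth-++ˡ (x ∷ xs) ys zero    _         = refl
nth-++ˡ (x ∷ xs) ys (suc i) (s≤s i<n) = nth-++ˡ xs ys i i<n

nth-at-length : ∀ xs y ys → nth (xs ++ y ∷ ys) (length xs) ≡ y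
nth-at-length []       y ys = refl
nth-at-length (x ∷ xs) y ys = nth-at-length xs y ys

nth-∈ : ∀ {P : ℕ → Set} xs i → All P xs → i < length xs → P (nth xs i)
nth-∈ (x ∷ xs) zero    (px ∷ _)  _         = px
nth-∈ (x ∷ xs) (suc i) (_ ∷ pxs) (s≤s i<n) = nth-∈ xs i pxs i<n

all-nth : ∀ {P : ℕ → Set} xs → (∀ i → i < length xs → P (nth xs i)) → All P xs
all-nth []       _ = []
all-nth (x ∷ xs) f = f zero (s≤s z≤n) ∷ all-nth xs (λ i i<n → f (suc i) (s≤s i<n))

LRMaxAt-prefix : ∀ xs ys q → q < length xs → LRMaxAt (xs ++ ys) q ⇔ LRMaxAt xs q
LRMaxAt-prefix xs ys q q<n = mk⇔
  (λ lr i i<q → subst₂ _<_ (nth-++ˡ xs ys i (<-trans i<q q<n)) (nth-++ˡ xs ys q q<n) (lr i i<q))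
  (λ lr i i<q → subst₂ _<_ (sym (nth-++ˡ xs ys i (<-trans i<q q<n))) (sym (nth-++ˡ xs ys q q<n)) (lr i i<q))

LRMaxAt-after : ∀ xs y ys → LRMaxAt (xs ++ y ∷ ys) (length xs) ⇔ All (_< y) xs
LRMaxAt-after xs y ys = mk⇔
  (λ lr → all-nth xs (λ i i<n → subst₂ _<_ (nth-++ˡ xs (y ∷ ys) i i<n) (nth-at-length xs y ys) (lr i i<n)))
  (λ xs<y i i<n → subst₂ _<_ (sym (nth-++ˡ xs (y ∷ ys) i i<n)) (sym (nth-at-length xs y ys)) (nth-∈ xs i xs<y i<n))

length-++-pair : ∀ P (b a : ℕ) → length (P ++ b ∷ a ∷ []) ≡ suc (suc (length P))
length-++-pair P b a = trans (length-++ P) (+-comm (length P) 2)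

peak-is-LRMax : ∀ P b a → All (_< a) P → b < a → LRMaxAt (P ++ b ∷ a ∷ []) (suc (length P))
peak-is-LRMax P b a P<a b<a = subst₂ LRMaxAt (++-assoc P (b ∷ []) (a ∷ [])) |P++b|
  (Equivalence.from (LRMaxAt-after (P ++ b ∷ []) a []) (All.++⁺ P<a (b<a ∷ [])))
  where
  |P++b| : length (P ++ b ∷ []) ≡ suc (length P)
  |P++b| = trans (length-++ P) (+-comm (length P) 1)

valley-not-LRMax : ∀ {j P x} b ys → Zigzag j P x → b < x → ¬ LRMaxAt (P ++ b ∷ ys) (length P)
valley-not-LRMax b ys zP b<x lr with zigzag-last zP
... | P′ , refl = <-asym b<x (All.head (All.++⁻ʳ P′ (Equivalence.to (LRMaxAt-after (P′ ++ _ ∷ []) b ys) lr)))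

zigzag-LR : ∀ {j P x} → Zigzag j P x → ∀ q → q < length P → LRMaxAt P q ⇔ Even q
zigzag-LR (single a) zero    _         = mk⇔ (λ _ → 0 , refl) (λ _ i ())
zigzag-LR (single a) (suc q) (s≤s ())
zigzag-LR (extend {j} {P} {x} {b} {a} zP P<a b<a b<x) q q<n
  with m<1+n⇒m<n∨m≡n (subst (q <_) (length-++-pair P b a) q<n)
... | inj₂ refl = mk⇔ (λ _ → subst Even (cong suc (sym (zigzag-length zP))) (suc j , sym (double-suc j)))
                      (λ _ → peak-is-LRMax P b a P<a b<a)
... | inj₁ q<1+P with m<1+n⇒m<n∨m≡n q<1+P
...   | inj₁ q<P  = ⇔-trans (LRMaxAt-prefix P (b ∷ a ∷ []) q q<P) (zigzag-LR zP q q<P)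
...   | inj₂ refl = mk⇔ (λ lr → ⊥-elim (valley-not-LRMax b (a ∷ []) zP b<x lr))
                        (λ ev → ⊥-elim (odd-not-even j (subst Even (zigzag-length zP) ev)))

extremal-LR : ∀ {k π} → ExtremalShape k π → ∀ q → q < length π →
              LRMaxAt π q ⇔ (Even q ⊎ suc q ≡ 2 * suc k)
extremal-LR {k} (zigzag-then-max {P} {x} {M} zP P<M) q q<n
  with m<1+n⇒m<n∨m≡n (subst (q <_) (trans (length-++ P) (+-comm (length P) 1)) q<n)
... | inj₁ q<P  = ⇔-trans (LRMaxAt-prefix P (M ∷ []) q q<P) (⇔-trans (zigzag-LR zP q q<P) (mk⇔ inj₁ not-last))
  where
  not-last : Even q ⊎ suc q ≡ 2 * suc k → Even q
  not-last (inj₁ ev) = ev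
  not-last (inj₂ eq) = ⊥-elim (<-irrefl refl
    (subst₂ _<_ (suc-injective (trans eq (double-suc k))) (zigzag-length zP) q<P))
... | inj₂ refl = mk⇔ (λ _ → inj₂ (trans (cong suc (zigzag-length zP)) (sym (double-suc k))))
                      (λ _ → Equivalence.from (LRMaxAt-after P M []) P<M)

proposition1 : (k : ℕ) (π : List ℕ) →
    IsPerm (2 * suc k) π → TwoSorted (2 * suc k) π → des π ≡ k →
    (j : Fin (length π)) →
    IsLRMax π j ⇔ ((Σ ℕ λ m → toℕ j ≡ 2 * m) ⊎ suc (toℕ j) ≡ 2 * suc k)
proposition1 k π _ (μ , μ↭ , ssμ≡π) des≡k j =
  ⇔-trans (isLRMax⇔LRMaxAt π j) (extremal-LR shape (toℕ j) (toℕ<n j))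
  where
  shape : ExtremalShape k π
  shape = subst (ExtremalShape k) ssμ≡π
    (two-sorted-extremal k μ (perm-unique μ↭) (trans (perm-length μ↭) (double-suc k))
                         (≤-reflexive (sym (trans (cong des ssμ≡π) des≡k))))
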